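{- For any $k>2$ there exist process templates $A,B$ forming 1-conjunctive systems, with $|B|=k$, such that $(A,B)^{(1,2|B|-2)}$ has a deadlocked run that is strong-fair initializing or finite, but $(A,B)^{(1,2|B|-3)}$ has no deadlocked run that is strong-fair initializing or finite.
   Context: A process template is $U=(Q_U,\mathrm{init}_U,\Sigma_U,\delta_U)$ with finite state set $Q_U$ containing initial state $\mathrm{init}_U$, finite input alphabet $\Sigma_U$, and guarded transition relation $\delta_U \subseteq Q_U \times \Sigma_U \times \mathcal{P}(Q_A \cup Q_B) \times Q_U$; $|B|=|Q_B|$. $Q_A,Q_B$ are disjoint, as are the alphabets. The system $(A,B)^{(1,n)}$ consists of one copy of $A$ and $n$ copies $B_1,\dots,B_n$ of $B$ in interleaving composition, starting with all processes in their initial states. A local transition $(q,\sigma,g,q')$ of process $p$ is enabled in global state $s$ with global input $e$ if $s(p)=q$, $e(p)=\sigma$ and (conjunctive interpretation) every process $p'\neq p$ has $s(p')\in g$; $\mathrm{init}_A,\mathrm{init}_B$ belong to every guard. The system is 1-conjunctive if every guard is of the form $(Q_A\cup Q_B)\setminus\{q\}$ for some state $q$. A process is enabled if one of its transitions is enabled; each global step moves exactly one process along an enabled local transition. A run is a maximal sequence of configurations $(s_t,e_t,p_t)$ from the initial state ($p_t$ the moving process; a configuration $(s,e,\bot)$ occurs exactly when all processes are disabled, ending the run), in which a process's input changes only when that process moves. A run is globally deadlocked if finite, locally deadlocked if infinite and some process is disabled at all moments from some point on, deadlocked if either. A run is strong-fair if it is infinite and every process enabled infinitely often moves infinitely often;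 it is initializing if every process that moves infinitely often visits its initial state infinitely often. -}

module Defs where

open import Data.Nat using (ℕ; zero; suc; _≤_)
open import Data.Fin using (Fin)
open import Data.Bool using (Bool; true; false)
open import Data.Sum using (_⊎_; inj₁; inj₂)
open import Data.Product using (Σ; ∃; ∃-syntax; _×_; _,_)
open import Data.List using (List)
open import Data.List.Membership.Propositional using (_∈_)
open import Data.Maybe using (Maybe; just; nothing)
open import Relation.Binary.PropositionalEquality using (_≡_; _≢_)
open import Relation.Nullary using (¬_)

-- Q_A = Fin mA, Q_B = Fin k; the disjoint union Q_A ∪ Q_B is Fin mA ⊎ Fin k.
-- A guard is a subset of Q_A ∪ Q_B, given by its characteristic function.
Guard : ℕ → ℕ → Set
Guard mA k = Fin mA ⊎ Fin k → Bool

record Trans (mA k nQ nΣ : ℕ) : Set where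
  constructor trans
  field
    src : Fin nQ
    inp : Fin nΣ
    grd : Guard mA k
    tgt : Fin nQ

record Template (mA k nQ : ℕ) : Set where
  field
    init : Fin nQ
    nΣ   : ℕ
    δ    : List (Trans mA k nQ nΣ)

open Trans public
open Template public

module _ {mA k : ℕ} (A : Template mA k mA) (B : Template mA k k) where

  GuardsContainInit : Set
  GuardsContainInit =
    (∀ t → t ∈ δ A → (grd t (inj₁ (init A)) ≡ true) × (grd t (inj₂ (init B)) ≡ true)) ×
    (∀ t → t ∈ δ B → (grd t (inj₁ (init A)) ≡ true) × (grd t (inj₂ (init B)) ≡ true))

  IsCoSingleton : Guard mA k → (Fin mA ⊎ Fin k) → Set
  IsCoSingleton g q = ∀ x → (g x ≡ false → x ≡ q) × (x ≡ q → g x ≡ false)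

  OneConjunctive : Set
  OneConjunctive =
    (∀ t → t ∈ δ A → ∃[ q ] IsCoSingleton (grd t) q) ×
    (∀ t → t ∈ δ B → ∃[ q ] IsCoSingleton (grd t) q)

  module System (n : ℕ) where

    data Proc : Set where
      pA : Proc
      pB : Fin n → Proc

    record GState : Set where
      field
        sA : Fin mA
        sB : Fin n → Fin k
    open GState public

    record GInput : Set where
      field
        eA : Fin (nΣ A)
        eB : Fin n → Fin (nΣ B)
    open GInput public

    loc : GState → Proc → Fin mA ⊎ Fin k
    loc s pA     = inj₁ (sA s)
    loc s (pB i) = inj₂ (sB s i)

    initOf : Proc → Fin mA ⊎ Fin k
    initOf pA     = inj₁ (init A)
    initOf (pB i) = inj₂ (init B)

    GuardOK : GState → Proc → Guard mA k → Set
    GuardOK s p g = ∀ p' → p' ≢ p → g (loc s p') ≡ true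

    EnabledTransA : GState → GInput → Trans mA k mA (nΣ A) → Set
    EnabledTransA s e t = (t ∈ δ A) × (src t ≡ sA s) × (inp t ≡ eA e) × GuardOK s pA (grd t)

    EnabledTransB : GState → GInput → Fin n → Trans mA k k (nΣ B) → Set
    EnabledTransB s e i t = (t ∈ δ B) × (src t ≡ sB s i) × (inp t ≡ eB e i) × GuardOK s (pB i) (grd t)

    Enabled : GState → GInput → Proc → Set
    Enabled s e pA     = ∃[ t ] EnabledTransA s e t
    Enabled s e (pB i) = ∃[ t ] EnabledTransB s e i t

    Step : GState → GInput → Proc → GState → Set
    Step s e pA s' = ∃[ t ] (EnabledTransA s e t × (sA s' ≡ tgt t) × (∀ j → sB s' j ≡ sB s j))
    Step s e (pB i) s' = ∃[ t ] (EnabledTransB s e i t × (sA s' ≡ sA s) × (sB s' i ≡ tgt t) ×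
                                  (∀ j → j ≢ i → sB s' j ≡ sB s j))

    InputFrame : GInput → GInput → Proc → Set
    InputFrame e e' p = (pA ≢ p → eA e' ≡ eA e) × (∀ j → pB j ≢ p → eB e' j ≡ eB e j)

    -- A run: configurations (st t, inp t, mv t); mv t ≡ nothing encodes
    -- the configuration (s, e, ⊥) which ends the run (later positions are padding).
    record Run : Set where
      field
        st  : ℕ → GState
        inp : ℕ → GInput
        mv  : ℕ → Maybe Proc
        start : (sA (st 0) ≡ init A) × (∀ j → sB (st 0) j ≡ init B)
        step  : ∀ t p → mv t ≡ just p →
                  Step (st t) (inp t) p (st (suc t)) × InputFrame (inp t) (inp (suc t)) p
        stop  : ∀ t → mv t ≡ nothing → ∀ p → ¬ Enabled (st t) (inp t) p
        pad   : ∀ t → mv t ≡ nothing → mv (suc t) ≡ nothing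
    open Run public

    InfOften : (ℕ → Set) → Set
    InfOften P = ∀ T → ∃[ t ] (T ≤ t × P t)

    Finite : Run → Set
    Finite r = ∃[ t ] (mv r t ≡ nothing)

    Infinite : Run → Set
    Infinite r = ∀ t → ∃[ p ] (mv r t ≡ just p)

    GloballyDeadlocked : Run → Set
    GloballyDeadlocked = Finite

    LocallyDeadlocked : Run → Set
    LocallyDeadlocked r = Infinite r ×
      ∃[ p ] ∃[ T ] (∀ t → T ≤ t → ¬ Enabled (st r t) (inp r t) p)

    Deadlocked : Run → Set
    Deadlocked r = GloballyDeadlocked r ⊎ LocallyDeadlocked r

    StrongFair : Run → Set
    StrongFair r = Infinite r ×
      (∀ p → InfOften (λ t → Enabled (st r t) (inp r t) p) → InfOften (λ t → mv r t ≡ just p))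

    Initializing : Run → Set
    Initializing r = ∀ p → InfOften (λ t → mv r t ≡ just p) →
                           InfOften (λ t → loc (st r t) p ≡ initOf p)

    HasBadRun : Set
    HasBadRun = ∃[ r ] (Deadlocked r × ((StrongFair r × Initializing r) ⊎ Finite r))

  HasDeadlock : ℕ → Set
  HasDeadlock n = System.HasBadRun n

-- A may always move to its state a₁ (and stay
-- there) as long as some B-state j ≠ 0 is empty; a B process moves from 0 to any j ≠ 0 while A
-- is not in a₁, and back from j to 0 only when it is alone in j.  Hence everybody is disabled
-- exactly when each of the k - 1 states j ≠ 0 holds two B processes and none is in 0: with
-- 2k - 2 processes the B's can fill these states one after another, with fewer this is
-- impossible by pigeonhole.  For any number of processes there is no strong-fair initializing
-- run: every B step either lowers the number of B processes in 0 or empties some j ≠ 0, so A is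
-- enabled infinitely often, hence moves, and then never returns to its initial state.
module Submission where

open import Defs
open import Data.Nat using (ℕ; zero; suc; _<_; _≤_; _≤′_; ≤′-refl; ≤′-step; _+_; _*_; _∸_; s≤s; s≤s⁻¹)
open import Data.Nat.Properties
  using (_<?_; ≤-refl; ≤-trans; ≤-reflexive; n≤1+n; n<1+n; <-≤-trans; <⇒≱; ≤∧≢⇒<; m<n⇒m<1+n; ≮⇒≥;
         +-monoʳ-<; *-suc; +-identityʳ; ≤⇒≤′; <-irrefl)
open import Data.Nat.Induction using (<-wellFounded)
open import Induction.WellFounded using (Acc; acc)
open import Data.Fin using (Fin; zero; suc; toℕ; fromℕ<; splitAt; join; _↑ˡ_; _↑ʳ_)
open import Data.Fin.Properties
  using (suc-injective; 0≢1+n; toℕ-injective; toℕ<n; toℕ-fromℕ<; splitAt-↑ˡ; splitAt-↑ʳ; join-splitAt;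
         injective⇒≤; any?)
  renaming (_≟_ to _≟ᶠ_)
open import Data.Bool using (Bool; true; false; not)
open import Data.Sum using (_⊎_; inj₁; inj₂; reduce)
open import Data.Sum.Properties using (inj₁-injective; inj₂-injective; ≡-dec)
open import Data.Product using (Σ; ∃-syntax; ∃₂; _×_; _,_; proj₁; proj₂)
open import Data.List using (map; _++_; allFin; cartesianProductWith)
open import Data.List.Membership.Propositional using (_∈_)
open import Data.List.Membership.Propositional.Properties
  using (∈-allFin; ∈-map⁺; ∈-map⁻; ∈-++⁺ˡ; ∈-++⁺ʳ; ∈-++⁻; ∈-cartesianProductWith⁺; ∈-cartesianProductWith⁻)
open import Data.Maybe using (Maybe; just; nothing)
open import Function using (_∘_; _⇔_; mk⇔)
open import Function.Definitions using (Injective)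
open import Relation.Binary.Definitions using (DecidableEquality)
open import Relation.Binary.PropositionalEquality using (_≡_; _≢_; refl; sym; cong; cong₂; subst)
import Relation.Binary.PropositionalEquality as ≡
open import Relation.Nullary using (¬_; Dec; yes; no; does; contradiction)
open import Relation.Nullary.Decidable using (dec-true; dec-false; does-⇔; ¬?; _×-dec_)

doubleCover⇒≤ : ∀ {m n} {X : Set} (f : Fin n → X) (c : Fin m → X) → Injective _≡_ _≡_ c →
                (∀ j → ∃₂ λ x y → x ≢ y × f x ≡ c j × f y ≡ c j) → m + m ≤ n
doubleCover⇒≤ {m} {n} f c c-injective cover =
  injective⇒≤ {f = pick ∘ splitAt m {m}} (splitAt-injective ∘ pick-injective)
  where
  pick : Fin m ⊎ Fin m → Fin n
  pick (inj₁ j) = proj₁ (cover j)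
  pick (inj₂ j) = proj₁ (proj₂ (cover j))

  pick-covers : ∀ u → f (pick u) ≡ c (reduce u)
  pick-covers (inj₁ j) with cover j
  ... | _ , _ , _ , fx≡cj , _ = fx≡cj
  pick-covers (inj₂ j) with cover j
  ... | _ , _ , _ , _ , fy≡cj = fy≡cj

  pick-distinct : ∀ j → pick (inj₁ j) ≢ pick (inj₂ j)
  pick-distinct j with cover j
  ... | _ , _ , x≢y , _ = x≢y

  pick-injective : ∀ {u v} → pick u ≡ pick v → u ≡ v
  pick-injective {u} {v} eq
    with c-injective (≡.trans (sym (pick-covers u)) (≡.trans (cong f eq) (pick-covers v)))
  pick-injective {inj₁ j} {inj₁ .j} _  | refl = refl
  pick-injective {inj₁ j} {inj₂ .j} eq | refl = contradiction eq (pick-distinct j)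
  pick-injective {inj₂ j} {inj₁ .j} eq | refl = contradiction (sym eq) (pick-distinct j)
  pick-injective {inj₂ j} {inj₂ .j} _  | refl = refl

  splitAt-injective : ∀ {i i′} → splitAt m i ≡ splitAt m i′ → i ≡ i′
  splitAt-injective {i} {i′} eq =
    ≡.trans (sym (join-splitAt m m i)) (≡.trans (cong (join m m) eq) (join-splitAt m m i′))

isZero : ∀ {k} → Fin (suc k) → ℕ
isZero zero    = 1
isZero (suc _) = 0

countZero : ∀ {n k} → (Fin n → Fin (suc k)) → ℕ
countZero {zero}  f = 0
countZero {suc n} f = isZero (f zero) + countZero (f ∘ suc)

countZero-cong : ∀ {n k} {f g : Fin n → Fin (suc k)} → (∀ i → g i ≡ f i) → countZero g ≡ countZero f
countZero-cong {zero}  _   = refl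
countZero-cong {suc n} g≗f = cong₂ _+_ (cong isZero (g≗f zero)) (countZero-cong (g≗f ∘ suc))

isZero-≢ : ∀ {k} {x : Fin (suc k)} → x ≢ zero → isZero x ≡ 0
isZero-≢ {x = zero}  x≢0 = contradiction refl x≢0
isZero-≢ {x = suc _} _   = refl

countZero-< : ∀ {n k} {f g : Fin n → Fin (suc k)} i → f i ≡ zero → g i ≢ zero →
              (∀ j → j ≢ i → g j ≡ f j) → countZero g < countZero f
countZero-< {suc n} {f = f} {g} zero fi≡0 gi≢0 same = begin-strict
  isZero (g zero) + countZero (g ∘ suc)  ≡⟨ cong₂ _+_ (isZero-≢ gi≢0) (countZero-cong (λ j → same (suc j) λ ())) ⟩
  countZero (f ∘ suc)                    <⟨ n<1+n _ ⟩
  suc (countZero (f ∘ suc))              ≡⟨ cong (λ x → isZero x + countZero (f ∘ suc)) fi≡0 ⟨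
  isZero (f zero) + countZero (f ∘ suc)  ∎
  where open Data.Nat.Properties.≤-Reasoning
countZero-< {suc n} {f = f} {g} (suc i) fi≡0 gi≢0 same = begin-strict
  isZero (g zero) + countZero (g ∘ suc)  ≡⟨ cong (_+ countZero (g ∘ suc)) (cong isZero (same zero λ ())) ⟩
  isZero (f zero) + countZero (g ∘ suc)  <⟨ +-monoʳ-< (isZero (f zero)) (countZero-< i fi≡0 gi≢0 same-tail) ⟩
  isZero (f zero) + countZero (f ∘ suc)  ∎
  where
  open Data.Nat.Properties.≤-Reasoning
  same-tail : ∀ j → j ≢ i → g (suc j) ≡ f (suc j)
  same-tail j j≢i = same (suc j) (j≢i ∘ suc-injective)

<-suc⇔< : ∀ {m n} → m ≢ n → m < suc n ⇔ m < n
<-suc⇔< m≢n = mk⇔ (λ m<1+n → ≤∧≢⇒< (s≤s⁻¹ m<1+n) m≢n) m<n⇒m<1+n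

onlyInput : (σ : Fin 1) → zero ≡ σ
onlyInput zero = refl

module Construction (K : ℕ) where

  U : Set
  U = Fin 2 ⊎ Fin (suc K)

  _≟_ : DecidableEquality U
  _≟_ = ≡-dec _≟ᶠ_ _≟ᶠ_

  allBut : U → Guard 2 (suc K)
  allBut q x = not (does (x ≟ q))

  allBut-self : ∀ q → allBut q q ≡ false
  allBut-self q = cong not (dec-true (q ≟ q) refl)

  allBut-≢ : ∀ {q x} → x ≢ q → allBut q x ≡ true
  allBut-≢ {q} {x} x≢q = cong not (dec-false (x ≟ q) x≢q)

  allBut-true⇒≢ : ∀ {q x} → allBut q x ≡ true → x ≢ q
  allBut-true⇒≢ {q} q∈allBut refl = contradiction (≡.trans (sym q∈allBut) (allBut-self q)) λ ()

  allBut-false⇒≡ : ∀ {q x} → allBut q x ≡ false → x ≡ q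
  allBut-false⇒≡ {q} {x} _  with x ≟ q
  allBut-false⇒≡         _  | yes x≡q = x≡q
  allBut-false⇒≡         () | no  _

  a₀ a₁ : Fin 2
  a₀ = zero
  a₁ = suc zero

  a₁≢a₀ : a₁ ≢ a₀
  a₁≢a₀ ()

  slot : Fin K → U
  slot j = inj₂ (suc j)

  moveA : Fin 2 → Fin K → Trans 2 (suc K) 2 1
  moveA a j = trans a zero (allBut (slot j)) a₁

  enterB leaveB : Fin K → Trans 2 (suc K) (suc K) 1
  enterB j = trans zero zero (allBut (inj₁ a₁)) (suc j)
  leaveB j = trans (suc j) zero (allBut (slot j)) zero

  TA : Template 2 (suc K) 2
  TA = record { init = a₀ ; nΣ = 1 ; δ = cartesianProductWith moveA (allFin 2) (allFin K) }

  TB : Template 2 (suc K) (suc K)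
  TB = record { init = zero ; nΣ = 1 ; δ = map enterB (allFin K) ++ map leaveB (allFin K) }

  moveA∈δ : ∀ a j → moveA a j ∈ δ TA
  moveA∈δ a j = ∈-cartesianProductWith⁺ moveA (∈-allFin a) (∈-allFin j)

  leaveB∈δ : ∀ j → leaveB j ∈ δ TB
  leaveB∈δ j = ∈-++⁺ʳ (map enterB (allFin K)) (∈-map⁺ leaveB (∈-allFin j))

  enterB∈δ : ∀ j → enterB j ∈ δ TB
  enterB∈δ j = ∈-++⁺ˡ (∈-map⁺ enterB (∈-allFin j))

  δA-shape : ∀ {t} → t ∈ δ TA → ∃₂ λ a j → t ≡ moveA a j
  δA-shape t∈δ with ∈-cartesianProductWith⁻ moveA (allFin 2) (allFin K) t∈δ
  ... | a , j , _ , _ , t≡ = a , j , t≡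

  δB-shape : ∀ {t} → t ∈ δ TB → ∃[ j ] (t ≡ enterB j ⊎ t ≡ leaveB j)
  δB-shape t∈δ with ∈-++⁻ (map enterB (allFin K)) t∈δ
  ... | inj₁ t∈enter with ∈-map⁻ enterB t∈enter
  ...   | j , _ , t≡ = j , inj₁ t≡
  δB-shape t∈δ | inj₂ t∈leave with ∈-map⁻ leaveB t∈leave
  ...   | j , _ , t≡ = j , inj₂ t≡

  AllButNonInitial : Guard 2 (suc K) → Set
  AllButNonInitial g = ∃[ q ] (g ≡ allBut q × inj₁ a₀ ≢ q × inj₂ zero ≢ q)

  δA-guard : ∀ {t} → t ∈ δ TA → AllButNonInitial (grd t)
  δA-guard t∈δ with δA-shape t∈δ
  ... | a , j , refl = slot j , refl , (λ ()) , (λ ())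

  δB-guard : ∀ {t} → t ∈ δ TB → AllButNonInitial (grd t)
  δB-guard t∈δ with δB-shape t∈δ
  ... | j , inj₁ refl = inj₁ a₁ , refl , (λ ()) , (λ ())
  ... | j , inj₂ refl = slot j , refl , (λ ()) , (λ ())

  guardsContainInit : GuardsContainInit TA TB
  guardsContainInit = (λ _ → containsInit ∘ δA-guard) , (λ _ → containsInit ∘ δB-guard)
    where
    containsInit : ∀ {g} → AllButNonInitial g → (g (inj₁ a₀) ≡ true) × (g (inj₂ zero) ≡ true)
    containsInit (_ , refl , a₀≢q , 0≢q) = allBut-≢ a₀≢q , allBut-≢ 0≢q

  oneConjunctive : OneConjunctive TA TB
  oneConjunctive = (λ _ → coSingleton ∘ δA-guard) , (λ _ → coSingleton ∘ δB-guard)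
    where
    coSingleton : ∀ {g} → AllButNonInitial g → ∃[ q ] IsCoSingleton TA TB g q
    coSingleton (q , refl , _) = q , λ _ → allBut-false⇒≡ , λ { refl → allBut-self q }

  module Behaviour (n : ℕ) where
    open System TA TB n

    pB-injective : ∀ {x y} → pB x ≡ pB y → x ≡ y
    pB-injective refl = refl

    Crowded : GState → Set
    Crowded s = ∀ j → ∃₂ λ x y → x ≢ y × sB s x ≡ suc j × sB s y ≡ suc j

    crowded⇒≤ : ∀ s → Crowded s → K + K ≤ n
    crowded⇒≤ s = doubleCover⇒≤ (sB s) suc suc-injective

    otherOccupant : ∀ s → Crowded s → ∀ j i → ∃[ z ] (z ≢ i × sB s z ≡ suc j)
    otherOccupant s crowded j i with crowded j
    ... | x , y , x≢y , x∈j , y∈j with x ≟ᶠ i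
    ...   | yes refl = y , x≢y ∘ sym , y∈j
    ...   | no  x≢i  = x , x≢i , x∈j

    A-enabled : ∀ s e j → (∀ x → sB s x ≢ suc j) → Enabled s e pA
    A-enabled s e j vacant = moveA (sA s) j , moveA∈δ (sA s) j , refl , onlyInput (eA e) , guardOK
      where
      guardOK : GuardOK s pA (allBut (slot j))
      guardOK pA     pA≢pA = contradiction refl pA≢pA
      guardOK (pB x) _     = allBut-≢ (vacant x ∘ inj₂-injective)

    B-enabled : ∀ s e i j → sB s i ≡ suc j → (∀ x → x ≢ i → sB s x ≢ suc j) → Enabled s e (pB i)
    B-enabled s e i j i∈j alone = leaveB j , leaveB∈δ j , sym i∈j , onlyInput (eB e i) , guardOK
      where
      guardOK : GuardOK s (pB i) (allBut (slot j))
      guardOK pA     _     = allBut-≢ {slot j} {inj₁ (sA s)} λ ()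
      guardOK (pB x) x≢i   = allBut-≢ (alone x (x≢i ∘ cong pB) ∘ inj₂-injective)

    deadlock⇒crowded : ∀ s e → (∀ p → ¬ Enabled s e p) → Crowded s
    deadlock⇒crowded s e dead j with any? (λ x → sB s x ≟ᶠ suc j)
    ... | no vacant = contradiction (A-enabled s e j (λ x x∈j → vacant (x , x∈j))) (dead pA)
    ... | yes (x , x∈j) with any? (λ y → ¬? (y ≟ᶠ x) ×-dec (sB s y ≟ᶠ suc j))
    ...   | no alone = contradiction (B-enabled s e x j x∈j (λ y y≢x y∈j → alone (y , y≢x , y∈j))) (dead (pB x))
    ...   | yes (y , y≢x , y∈j) = x , y , y≢x ∘ sym , x∈j , y∈j

    crowded⇒deadlock : ∀ s e → (∀ i → sB s i ≢ zero) → Crowded s → ∀ p → ¬ Enabled s e p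
    crowded⇒deadlock s e _ crowded pA (t , t∈δ , _ , _ , guardOK) with δA-shape t∈δ
    ... | a , j , refl with crowded j
    ...   | x , _ , _ , x∈j , _ = allBut-true⇒≢ (guardOK (pB x) λ ()) (cong inj₂ x∈j)
    crowded⇒deadlock s e occupied crowded (pB i) (t , t∈δ , src≡ , _ , guardOK) with δB-shape t∈δ
    ... | j , inj₁ refl = occupied i (sym src≡)
    ... | j , inj₂ refl with otherOccupant s crowded j i
    ...   | z , z≢i , z∈j = allBut-true⇒≢ (guardOK (pB z) (z≢i ∘ pB-injective)) (cong inj₂ z∈j)

    step⇒enabled : ∀ {s e s′} p → Step s e p s′ → Enabled s e p
    step⇒enabled pA     (t , enabled , _) = t , enabled
    step⇒enabled (pB i) (t , enabled , _) = t , enabled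

    A-step-to-a₁ : ∀ {s e s′} → Step s e pA s′ → sA s′ ≡ a₁
    A-step-to-a₁ (t , (t∈δ , _) , sA′≡ , _) with δA-shape t∈δ
    ... | a , j , refl = sA′≡

    B-step-keeps-A : ∀ {s e s′ i} → Step s e (pB i) s′ → sA s′ ≡ sA s
    B-step-keeps-A (_ , _ , sA′≡ , _) = sA′≡

    B-step-progress : ∀ {s e s′ e′ i} → Step s e (pB i) s′ →
                      countZero (sB s′) < countZero (sB s) ⊎ Enabled s′ e′ pA
    B-step-progress {s} {s′ = s′} {e′} {i} (t , (t∈δ , src≡ , _ , guardOK) , _ , tgt≡ , others)
      with δB-shape t∈δ
    ... | j , inj₁ refl = inj₁ (countZero-< i (sym src≡) (λ i∈0 → 0≢1+n (≡.trans (sym i∈0) tgt≡)) others)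
    ... | j , inj₂ refl = inj₂ (A-enabled s′ e′ j vacated)
      where
      vacated : ∀ x → sB s′ x ≢ suc j
      vacated x x∈j with x ≟ᶠ i
      ... | yes refl with ≡.trans (sym tgt≡) x∈j
      ...   | ()
      vacated x x∈j | no x≢i =
        allBut-true⇒≢ (guardOK (pB x) (x≢i ∘ pB-injective)) (cong inj₂ (≡.trans (sym (others x x≢i)) x∈j))

    module _ (r : Run) (r-infinite : Infinite r) where

      stepAt : ∀ t p → mv r t ≡ just p → Step (st r t) (inp r t) p (st r (suc t))
      stepAt t p moved = proj₁ (step r t p moved)

      A-enabled-infinitely-often : InfOften (λ t → Enabled (st r t) (inp r t) pA)
      A-enabled-infinitely-often T = go T (<-wellFounded _)
        where
        go : ∀ T → Acc _<_ (countZero (sB (st r T))) → ∃[ t ] (T ≤ t × Enabled (st r t) (inp r t) pA)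
        go T (acc smaller) with r-infinite T
        ... | pA , moved = T , ≤-refl , step⇒enabled {e = inp r T} pA (stepAt T pA moved)
        ... | pB i , moved with B-step-progress {e = inp r T} {e′ = inp r (suc T)} (stepAt T (pB i) moved)
        ...   | inj₂ enabled = suc T , n≤1+n T , enabled
        ...   | inj₁ fewer with go (suc T) (smaller fewer)
        ...     | t , T<t , enabled = t , ≤-trans (n≤1+n T) T<t , enabled

      A-next : ∀ t → sA (st r (suc t)) ≡ a₁ ⊎ sA (st r (suc t)) ≡ sA (st r t)
      A-next t with r-infinite t
      ... | pA   , moved = inj₁ (A-step-to-a₁ {e = inp r t} (stepAt t pA moved))
      ... | pB i , moved = inj₂ (B-step-keeps-A {e = inp r t} (stepAt t (pB i) moved))

      A-stays-at-a₁ : ∀ {t t′} → t ≤′ t′ → sA (st r t) ≡ a₁ → sA (st r t′) ≡ a₁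
      A-stays-at-a₁ ≤′-refl at-a₁ = at-a₁
      A-stays-at-a₁ (≤′-step {t′} t≤t′) at-a₁ with A-next t′
      ... | inj₁ next-at-a₁ = next-at-a₁
      ... | inj₂ unchanged  = ≡.trans unchanged (A-stays-at-a₁ t≤t′ at-a₁)

      A-at-a₁-after-move : ∀ {t t′} → mv r t ≡ just pA → suc t ≤ t′ → sA (st r t′) ≡ a₁
      A-at-a₁-after-move {t} moved t<t′ =
        A-stays-at-a₁ (≤⇒≤′ t<t′) (A-step-to-a₁ {e = inp r t} (stepAt t pA moved))

    no-fair-initializing-run : ∀ r → StrongFair r → ¬ Initializing r
    no-fair-initializing-run r (r-infinite , fair) initializing =
      let A-moves              = fair pA (A-enabled-infinitely-often r r-infinite)
          t₁ , _ , moved       = A-moves 0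
          t₂ , t₁<t₂ , at-init = initializing pA A-moves (suc t₁)
      in  a₁≢a₀ (≡.trans (sym (A-at-a₁-after-move r r-infinite moved t₁<t₂)) (inj₁-injective at-init))

    no-deadlock-below : n < K + K → ¬ HasDeadlock TA TB n
    no-deadlock-below _    (r , _ , inj₁ (fair , initializing)) = no-fair-initializing-run r fair initializing
    no-deadlock-below n<2K (r , _ , inj₂ (t , stopped)) =
      <⇒≱ n<2K (crowded⇒≤ (st r t) (deadlock⇒crowded (st r t) (inp r t) (stop r t stopped)))

  module Witness where
    N : ℕ
    N = K + K

    open System TA TB N
    open Behaviour N using (Crowded; crowded⇒deadlock)

    column : Fin N → Fin K
    column = reduce ∘ splitAt K

    position : Bool → Fin N → Fin (suc K)
    position false _ = zero
    position true  i = suc (column i)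

    -- B process i enters state suc (column i) at time toℕ i; each column is the column of
    -- exactly one process in either half of Fin (K + K).
    state : ℕ → GState
    state t = record { sA = a₀ ; sB = λ i → position (does (toℕ i <? t)) i }

    input : GInput
    input = record { eA = zero ; eB = λ _ → zero }

    moveAt : ∀ {t} → Dec (t < N) → Maybe Proc
    moveAt (yes t<N) = just (pB (fromℕ< t<N))
    moveAt (no  _)   = nothing

    move : ℕ → Maybe Proc
    move t = moveAt (t <? N)

    enterStep : ∀ t (t<N : t < N) → Step (state t) input (pB (fromℕ< t<N)) (state (suc t))
    enterStep t t<N =
      enterB (column i) , (enterB∈δ (column i) , sym not-yet , refl , guardOK) , refl , now , unchanged
      where
      i : Fin N
      i = fromℕ< t<N
      i≡t : toℕ i ≡ t
      i≡t = toℕ-fromℕ< t<N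
      not-yet : sB (state t) i ≡ zero
      not-yet = cong (λ b → position b i) (dec-false (toℕ i <? t) (<-irrefl i≡t))
      now : sB (state (suc t)) i ≡ suc (column i)
      now = cong (λ b → position b i) (dec-true (toℕ i <? suc t) (s≤s (≤-reflexive i≡t)))
      unchanged : ∀ x → x ≢ i → sB (state (suc t)) x ≡ sB (state t) x
      unchanged x x≢i = cong (λ b → position b x)
        (does-⇔ (<-suc⇔< (x≢i ∘ toℕ-injective ∘ λ x≡t → ≡.trans x≡t (sym i≡t))) (toℕ x <? suc t) (toℕ x <? t))
      guardOK : GuardOK (state t) (pB i) (allBut (inj₁ a₁))
      guardOK pA     _ = allBut-≢ {inj₁ a₁} {inj₁ a₀} λ ()
      guardOK (pB x) _ = allBut-≢ {inj₁ a₁} {inj₂ (sB (state t) x)} λ ()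

    finished : ∀ {t} → N ≤ t → ∀ i → sB (state t) i ≡ suc (column i)
    finished {t} N≤t i = cong (λ b → position b i) (dec-true (toℕ i <? t) (<-≤-trans (toℕ<n i) N≤t))

    finished-crowded : ∀ {t} → N ≤ t → Crowded (state t)
    finished-crowded N≤t j =
      j ↑ˡ K , K ↑ʳ j , halves-disjoint ,
      ≡.trans (finished N≤t (j ↑ˡ K)) (cong (suc ∘ reduce) (splitAt-↑ˡ K j K)) ,
      ≡.trans (finished N≤t (K ↑ʳ j)) (cong (suc ∘ reduce) (splitAt-↑ʳ K K j))
      where
      halves-disjoint : j ↑ˡ K ≢ K ↑ʳ j
      halves-disjoint eq
        with ≡.trans (sym (splitAt-↑ˡ K j K)) (≡.trans (cong (splitAt K) eq) (splitAt-↑ʳ K K j))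
      ... | ()

    move-≥ : ∀ {t} → N ≤ t → move t ≡ nothing
    move-≥ {t} N≤t with t <? N
    ... | yes t<N = contradiction N≤t (<⇒≱ t<N)
    ... | no  _   = refl

    halted : ∀ {t} → move t ≡ nothing → N ≤ t
    halted {t} stopped with t <? N
    halted ()         | yes _
    halted _          | no t≮N = ≮⇒≥ t≮N

    run : Run
    run = record
      { st    = state
      ; inp   = λ _ → input
      ; mv    = move
      ; start = refl , λ _ → refl
      ; step  = moves
      ; stop  = λ t stopped → crowded⇒deadlock (state t) input
                                (occupied (halted stopped)) (finished-crowded (halted stopped))
      ; pad   = λ t stopped → move-≥ (≤-trans (halted stopped) (n≤1+n t))
      }
      where
      moves : ∀ t p → move t ≡ just p →
              Step (state t) input p (state (suc t)) × InputFrame input input p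
      moves t _ moved with t <? N
      moves t _ refl | yes t<N = enterStep t t<N , (λ _ → refl) , (λ _ _ → refl)
      moves t _ ()   | no  _
      occupied : ∀ {t} → N ≤ t → ∀ i → sB (state t) i ≢ zero
      occupied N≤t i at0 = 0≢1+n (≡.trans (sym at0) (finished N≤t i))

    deadlock-at-2K : HasDeadlock TA TB N
    deadlock-at-2K = run , inj₁ (N , halt) , inj₂ (N , halt)
      where
      halt : move N ≡ nothing
      halt = move-≥ ≤-refl

2*[1+n]≡2+[n+n] : ∀ n → 2 * suc n ≡ 2 + (n + n)
2*[1+n]≡2+[n+n] n = ≡.trans (*-suc 2 n) (cong (λ x → 2 + (n + x)) (+-identityʳ n))

mainTheorem19 : ∀ (k : ℕ) → 2 < k →
    ∃[ mA ] Σ (Template mA k mA) λ A → Σ (Template mA k k) λ B →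
      GuardsContainInit A B × OneConjunctive A B ×
      HasDeadlock A B (2 * k ∸ 2) × ¬ HasDeadlock A B (2 * k ∸ 3)
mainTheorem19 (suc K@(suc (suc _))) (s≤s (s≤s (s≤s _))) =
  2 , TA , TB , guardsContainInit , oneConjunctive ,
  subst (HasDeadlock TA TB) (sym 2k∸2≡N) deadlock-at-2K ,
  Behaviour.no-deadlock-below _ 2k∸3<N
  where
  open Construction K
  open Witness using (N; deadlock-at-2K)

  2k∸2≡N : 2 * suc K ∸ 2 ≡ N
  2k∸2≡N = cong (_∸ 2) (2*[1+n]≡2+[n+n] K)

  2k∸3<N : 2 * suc K ∸ 3 < N
  2k∸3<N = subst (_< N) (cong (_∸ 3) (sym (2*[1+n]≡2+[n+n] K))) (n<1+n _)
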